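{- Let $D=(V,A)$ be a loopless digraph with minimum in-degree at least $1$, and let $\mathcal{L}D=\mathcal{L}_{(A',\phi)}D$ be a partial line digraph of $D$. Then $\mathcal{L}D$ has a semikernel if and only if $D$ has a semikernel.
   Context: For $U\subseteq V$, $\omega^-(U)=\{(x,y)\in A: y\in U, x\notin U\}$ and $\omega^+(U)=\{(x,y)\in A: x\in U, y\notin U\}$; $\omega^-(x)$ is the set of arcs with terminal vertex $x$. A set $S$ is independent if no arc joins two of its vertices. A semikernel of a digraph is an independent set $S$ such that for every arc $(s,x)\in\omega^+(S)$ there is an arc $(x,s')\in\omega^-(S)$. For a set of arcs $\Omega$, $H(\Omega)=\{y:(x,y)\in\Omega\}$. An arc $(i,j)$ is written $ij$. Partial line digraph: take $A'\subseteq A$ and a surjective map $\phi:A\to A'$ such that (i) $H(A')=V$; (ii) $\phi|_{A'}$ is the identity, and for every $j\in V$, $\phi(\omega^-(j))\subseteq\omega^-(j)\cap A'$. Then $\mathcal{L}_{(A',\phi)}D$ has vertex set $A'$ and arc set $\{(ij,\phi(jk)): ij\in A',\ (j,k)\in A\}$. -}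

module Defs where

open import Data.Nat using (ℕ)
open import Data.Fin using (Fin)
open import Data.Bool using (Bool; true; false; T)
open import Data.Product using (Σ; Σ-syntax; ∃; ∃-syntax; _×_; _,_; proj₁; proj₂)
open import Relation.Binary.PropositionalEquality using (_≡_)
open import Relation.Nullary using (¬_)
open import Level using (Level; _⊔_; suc)

module _ {a b : Level} {V : Set a} (E : V → V → Set b) where

  Independent : (V → Set) → Set (a ⊔ b)
  Independent S = ∀ x y → S x → S y → ¬ E x y

  IsSemikernel : (V → Set) → Set (a ⊔ b)
  IsSemikernel S =
    (∃[ s ] S s) ×
    Independent S ×
    (∀ s x → S s → ¬ S x → E s x → ∃[ s' ] (S s' × E x s'))

  HasSemikernel : Set (Level.suc Level.zero ⊔ a ⊔ b)
  HasSemikernel = Σ[ S ∈ (V → Set) ] IsSemikernel S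

record Digraph : Set where
  field
    n   : ℕ
    adj : Fin n → Fin n → Bool

module _ (D : Digraph) where
  open Digraph D

  Vertex : Set
  Vertex = Fin n

  Arc : Set
  Arc = Σ[ p ∈ Fin n × Fin n ] T (adj (proj₁ p) (proj₂ p))

  tail : Arc → Vertex
  tail ((x , _) , _) = x

  head : Arc → Vertex
  head ((_ , y) , _) = y

  Edge : Vertex → Vertex → Set
  Edge x y = T (adj x y)

  Loopless : Set
  Loopless = ∀ x → adj x x ≡ false

  MinInDegreeAtLeast1 : Set
  MinInDegreeAtLeast1 = ∀ y → ∃[ x ] Edge x y

  record PLDData : Set where
    field
      inA'   : Arc → Bool
      φ      : Arc → Arc
      φ-into : ∀ a → T (inA' (φ a))
      φ-surj : ∀ a → T (inA' a) → ∃[ b ] (φ b ≡ a)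
      H-A'   : ∀ y → ∃[ a ] (T (inA' a) × head a ≡ y)
      φ-id   : ∀ a → T (inA' a) → φ a ≡ a
      φ-head : ∀ a → head (φ a) ≡ head a                  -- φ(ω⁻(j)) ⊆ ω⁻(j) ∩ A'

  module _ (P : PLDData) where
    open PLDData P

    LVertex : Set
    LVertex = Σ[ a ∈ Arc ] T (inA' a)

    LEdge : LVertex → LVertex → Set
    LEdge (a , _) (b , _) = Σ[ c ∈ Arc ] (tail c ≡ head a × φ c ≡ b)

-- Map every vertex ij of the partial line digraph to its head j.  This map
-- sends arcs to arcs, lifts every arc of D leaving j to an arc leaving ij
-- (via φ), and the out-arcs of ij depend only on j.  For any such map
-- preimages of semikernels are semikernels, and so are images: if two
-- image vertices were adjacent, the lifted arc either stays in the
-- semikernel (violating independence) or is absorbed back into it, which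
-- projects to an arc between two of its vertices.
module Submission where

open import Defs
open import Data.Product using (_×_; _,_; proj₁; proj₂; ∃-syntax)
open import Function using (_∘_)
open import Relation.Nullary using (¬_)
open import Relation.Binary.PropositionalEquality using (_≡_; refl; sym; trans; subst₂)

record IsOutCover {V W : Set} (E : V → V → Set) (F : W → W → Set) (f : W → V) : Set where
  field
    surjective    : ∀ v → ∃[ w ] f w ≡ v
    homomorphism  : ∀ {u w} → F u w → E (f u) (f w)
    lift          : ∀ {u y} → E (f u) y → ∃[ w ] (f w ≡ y × F u w)
    out-invariant : ∀ {u u′ w} → f u ≡ f u′ → F u w → F u′ w

Image : {V W : Set} → (W → V) → (W → Set) → V → Set
Image f S v = ∃[ w ] (S w × f w ≡ v)

module _ {V W : Set} {E : V → V → Set} {F : W → W → Set} {f : W → V}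
         (cover : IsOutCover E F f) where
  open IsOutCover cover

  preimage-isSemikernel : ∀ {S} → IsSemikernel E S → IsSemikernel F (S ∘ f)
  preimage-isSemikernel {S} ((s , Ss) , independent , absorbing) =
    nonempty , independent′ , absorbing′
    where
    nonempty : ∃[ w ] S (f w)
    nonempty with surjective s
    ... | w , refl = w , Ss

    independent′ : Independent F (S ∘ f)
    independent′ u w Su Sw = independent (f u) (f w) Su Sw ∘ homomorphism

    absorbing′ : ∀ u x → S (f u) → ¬ S (f x) → F u x → ∃[ u′ ] (S (f u′) × F x u′)
    absorbing′ u x Su ¬Sx ux with absorbing (f u) (f x) Su ¬Sx (homomorphism ux)
    ... | s′ , Ss′ , xs′ with lift xs′
    ...   | u′ , refl , xu′ = u′ , Ss′ , xu′

  image-isSemikernel : ∀ {S} → IsSemikernel F S → IsSemikernel E (Image f S)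
  image-isSemikernel {S} ((w₀ , Sw₀) , independent , absorbing) =
    (f w₀ , w₀ , Sw₀ , refl) , independent′ , absorbing′
    where
    independent′ : Independent E (Image f S)
    independent′ x y (u , Su , refl) (w , Sw , fw≡y) xy with lift xy
    ... | w′ , fw′≡y , uw′ = w′∈S-absurd (λ Sw′ → independent u w′ Su Sw′ uw′)
      where
      w′∈S-absurd : ¬ ¬ S w′
      w′∈S-absurd ¬Sw′ with absorbing u w′ Su ¬Sw′ uw′
      ... | s′ , Ss′ , w′s′ =
        independent w s′ Sw Ss′ (out-invariant (trans fw′≡y (sym fw≡y)) w′s′)

    absorbing′ : ∀ s x → Image f S s → ¬ Image f S x → E s x → ∃[ s′ ] (Image f S s′ × E x s′)
    absorbing′ _ x (u , Su , refl) ¬Sx ux with lift ux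
    ... | w′ , refl , uw′ with absorbing u w′ Su (λ Sw′ → ¬Sx (w′ , Sw′ , refl)) uw′
    ...   | s′ , Ss′ , w′s′ = f s′ , (s′ , Ss′ , refl) , homomorphism w′s′

  hasSemikernel-transfer : (HasSemikernel F → HasSemikernel E) × (HasSemikernel E → HasSemikernel F)
  hasSemikernel-transfer = (λ (S , sk) → Image f S , image-isSemikernel sk)
                                 , (λ (S , sk) → S ∘ f , preimage-isSemikernel sk)

module _ (D : Digraph) (P : PLDData D) where
  open PLDData P

  lineHead : LVertex D P → Vertex D
  lineHead = head D ∘ proj₁

  lineHead-isOutCover : IsOutCover (Edge D) (LEdge D P) lineHead
  -- LEdge ignores the A'-membership proofs, so the implicit endpoints
  -- cannot be inferred and are passed on explicitly.
  lineHead-isOutCover = record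
    { surjective    = surjective
    ; homomorphism  = λ {a} {b} → homomorphism {a} {b}
    ; lift          = λ {a} → lift {a}
    ; out-invariant = λ {a} {a′} {b} → out-invariant {a} {a′} {b}
    }
    where
    surjective : ∀ v → ∃[ a ] lineHead a ≡ v
    surjective v with H-A' v
    ... | a , a∈A' , ha≡v = (a , a∈A') , ha≡v

    homomorphism : ∀ {a b} → LEdge D P a b → Edge D (lineHead a) (lineHead b)
    homomorphism (c , tc≡ha , refl) = subst₂ (Edge D) tc≡ha (sym (φ-head c)) (proj₂ c)

    lift : ∀ {a y} → Edge D (lineHead a) y → ∃[ b ] (lineHead b ≡ y × LEdge D P a b)
    lift {a} {y} e = (φ c , φ-into c) , φ-head c , c , refl , refl
      where
      c : Arc D
      c = (lineHead a , y) , e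

    out-invariant : ∀ {a a′ b} → lineHead a ≡ lineHead a′ → LEdge D P a b → LEdge D P a′ b
    out-invariant ha≡ha′ (c , tc≡ha , φc≡b) = c , trans tc≡ha ha≡ha′ , φc≡b

theorem2p7 : (D : Digraph) → Loopless D → MinInDegreeAtLeast1 D →
    (P : PLDData D) →
    (HasSemikernel (LEdge D P) → HasSemikernel (Edge D)) ×
    (HasSemikernel (Edge D) → HasSemikernel (LEdge D P))
theorem2p7 D _ _ P = hasSemikernel-transfer (lineHead-isOutCover D P)
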